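{- Let $k,l\ge3$ be integers, let $R_i=\{i,k+i,\ldots,(l-1)k+i\}$ for $i\in[k]$ and $C_j=\{(j-1)k+1,\ldots,jk\}$ for $j\in[l]$, let $\Delta$ be the set of 3-subsets of $[kl]$ contained in some $R_i$ or some $C_j$, and let $G_{k,l}$ be the matroid on $[kl]$ whose circuits are the inclusion-minimal members of $\Delta\cup\binom{[kl]}{4}$. Then $G_{k,l}$ is a tame paving matroid.
   Context: A rank-$n$ matroid is paving if all circuits have size $n$ or $n+1$; its dependent hyperplanes are the maximal sets of size $\ge n$ all of whose $n$-subsets are circuits; it is tame if any three distinct dependent hyperplanes have empty intersection. -}

module Defs where

open import Data.Nat using (ℕ; _+_; _*_; _≤_; _≥_)
open import Data.Fin using (Fin; toℕ)
open import Data.Fin.Subset using (Subset; _∈_; _⊆_; _∩_; _∪_; _-_; ∣_∣; ⊥)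
open import Data.Product using (Σ; ∃; _×_; _,_)
open import Data.Sum using (_⊎_)
open import Relation.Nullary using (¬_)
open import Relation.Binary.PropositionalEquality using (_≡_; _≢_)

record IsMatroidByCircuits {n : ℕ} (Circ : Subset n → Set) : Set where
  field
    C1 : ¬ Circ ⊥
    C2 : ∀ {C D} → Circ C → Circ D → C ⊆ D → C ≡ D
    C3 : ∀ {C D e} → Circ C → Circ D → C ≢ D → e ∈ C → e ∈ D →
         Σ (Subset n) λ E → Circ E × E ⊆ ((C ∪ D) - e)

module _ {n : ℕ} (Circ : Subset n → Set) where

  Independent : Subset n → Set
  Independent I = ∀ C → C ⊆ I → ¬ Circ C

  HasRank : ℕ → Set
  HasRank r = (Σ (Subset n) λ I → Independent I × ∣ I ∣ ≡ r)
            × (∀ I → Independent I → ∣ I ∣ ≤ r)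

  IsPaving : ℕ → Set
  IsPaving r = HasRank r × (∀ C → Circ C → ∣ C ∣ ≡ r ⊎ ∣ C ∣ ≡ r + 1)

  AllRSubsetsCircuits : ℕ → Subset n → Set
  AllRSubsetsCircuits r H = ∀ S → S ⊆ H → ∣ S ∣ ≡ r → Circ S

  IsDependentHyperplane : ℕ → Subset n → Set
  IsDependentHyperplane r H =
    ∣ H ∣ ≥ r × AllRSubsetsCircuits r H
    × (∀ H′ → ∣ H′ ∣ ≥ r → AllRSubsetsCircuits r H′ → H ⊆ H′ → H′ ≡ H)

  IsTame : ℕ → Set
  IsTame r = ∀ H₁ H₂ H₃ → IsDependentHyperplane r H₁ → IsDependentHyperplane r H₂
           → IsDependentHyperplane r H₃ → H₁ ≢ H₂ → H₁ ≢ H₃ → H₂ ≢ H₃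
           → (H₁ ∩ H₂) ∩ H₃ ≡ ⊥

-- The matroid G_{k,l} on [kl], 0-indexed: element x ∈ Fin (k*l) stands
-- for x+1 ∈ [kl]; index i ∈ Fin k stands for i+1 ∈ [k], j ∈ Fin l for j+1.

module _ (k l : ℕ) where

  InR : Fin k → Fin (k * l) → Set
  InR i x = ∃ λ (q : Fin l) → toℕ x ≡ toℕ q * k + toℕ i

  InC : Fin l → Fin (k * l) → Set
  InC j x = ∃ λ (r : Fin k) → toℕ x ≡ toℕ j * k + toℕ r

  InΔ : Subset (k * l) → Set
  InΔ S = ∣ S ∣ ≡ 3 ×
          ((∃ λ (i : Fin k) → ∀ x → x ∈ S → InR i x)
          ⊎ (∃ λ (j : Fin l) → ∀ x → x ∈ S → InC j x))

  InFamily : Subset (k * l) → Set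
  InFamily S = InΔ S ⊎ ∣ S ∣ ≡ 4

  GCircuit : Subset (k * l) → Set
  GCircuit S = InFamily S × (∀ T → InFamily T → T ⊆ S → T ≡ S)

-- Arrange the kl elements in an l × k grid, the C_j being its rows and the R_i its
-- columns; Δ is then the set of collinear triples of a point–line geometry in which
-- two distinct lines share at most one point. In any such geometry the minimal
-- members of Δ ∪ binom([n], 4) are the circuits of a paving matroid, of rank 3 as
-- soon as some triple is not collinear. For circuit elimination, two distinct
-- circuits through e either span at least five points, so that removing e leaves a
-- 4-set, or they are collinear triples meeting in two points, hence lie on one line
-- with the three points that remain. Every dependent hyperplane lies on a line, and
-- two of them on the same line coincide by maximality; so tameness holds because
-- no point of the grid lies on three lines: it lies on one row and one column.
module Submission where

open import Defs
open import Data.Empty using (⊥-elim)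
open import Data.Fin.Base using (Fin; toℕ; combine; cast) renaming (zero to fzero; suc to fsuc)
open import Data.Fin.Properties using (toℕ-injective; toℕ-combine; combine-injective; toℕ-cast; suc-injective; any?; all?; _≟_)
open import Data.Fin.Subset
open import Data.Fin.Subset.Properties
open import Data.Nat.Base using (ℕ; zero; suc; _+_; _*_; _≤_; _<_; _≥_; s≤s; s≤s⁻¹)
import Data.Nat.Properties as ℕ
open import Data.Nat.Properties using (_≤?_; ≤-trans; ≤-reflexive; ≤-antisym; ≰⇒>; <⇒≱; +-suc; +-cancelˡ-≡; *-comm)
open import Data.Product.Base using (∃; ∃₂; _×_; _,_; proj₁; proj₂)
open import Data.Vec.Base using ([]; _∷_; here; there)
open import Data.Sum.Base using (_⊎_; inj₁; inj₂; [_,_]′)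
open import Function.Base using (_∘_)
open import Function.Bundles using (_⇔_; mk⇔; Equivalence)
open import Relation.Nullary using (¬_; Dec; yes; no; contradiction)
open import Relation.Nullary.Decidable using (_×-dec_; _⊎-dec_; _→-dec_)
open import Relation.Unary using (Decidable)
open import Relation.Binary.PropositionalEquality using (_≡_; _≢_; refl; sym; trans; cong; cong₂; subst; module ≡-Reasoning)

p⊆q⇒∣q∣≤∣p∣⇒p≡q : ∀ {n} (p q : Subset n) → p ⊆ q → ∣ q ∣ ≤ ∣ p ∣ → p ≡ q
p⊆q⇒∣q∣≤∣p∣⇒p≡q [] [] _ _ = refl
p⊆q⇒∣q∣≤∣p∣⇒p≡q (inside ∷ p) (inside ∷ q) p⊆q ∣q∣≤∣p∣ =
  cong (inside ∷_) (p⊆q⇒∣q∣≤∣p∣⇒p≡q p q (drop-∷-⊆ p⊆q) (s≤s⁻¹ ∣q∣≤∣p∣))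
p⊆q⇒∣q∣≤∣p∣⇒p≡q (outside ∷ p) (outside ∷ q) p⊆q ∣q∣≤∣p∣ =
  cong (outside ∷_) (p⊆q⇒∣q∣≤∣p∣⇒p≡q p q (drop-∷-⊆ p⊆q) ∣q∣≤∣p∣)
p⊆q⇒∣q∣≤∣p∣⇒p≡q (inside ∷ p) (outside ∷ q) p⊆q _ with p⊆q here
... | ()
p⊆q⇒∣q∣≤∣p∣⇒p≡q (outside ∷ p) (inside ∷ q) p⊆q ∣q∣≤∣p∣ =
  contradiction ∣q∣≤∣p∣ (<⇒≱ (s≤s (p⊆q⇒∣p∣≤∣q∣ (drop-∷-⊆ p⊆q))))

subset-of-size : ∀ {n} m (p : Subset n) → m ≤ ∣ p ∣ → ∃ λ q → q ⊆ p × ∣ q ∣ ≡ m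
subset-of-size {n} zero p _ = ⊥ , ⊥⊆ , ∣⊥∣≡0 n
subset-of-size (suc m) (inside ∷ p) 1+m≤∣p∣ with q , q⊆p , ∣q∣≡m ← subset-of-size m p (s≤s⁻¹ 1+m≤∣p∣) =
  inside ∷ q , in⊆in q⊆p , cong suc ∣q∣≡m
subset-of-size (suc m) (outside ∷ p) 1+m≤∣p∣ with q , q⊆p , ∣q∣≡m ← subset-of-size (suc m) p 1+m≤∣p∣ =
  outside ∷ q , out⊆ q⊆p , ∣q∣≡m

1≤∣p∣⇒nonempty : ∀ {n} (p : Subset n) → 1 ≤ ∣ p ∣ → Nonempty p
1≤∣p∣⇒nonempty (inside ∷ p) _ = fzero , here
1≤∣p∣⇒nonempty (outside ∷ p) 1≤∣p∣ with x , x∈p ← 1≤∣p∣⇒nonempty p 1≤∣p∣ = fsuc x , there x∈p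

2≤∣p∣⇒distinct-pair : ∀ {n} (p : Subset n) → 2 ≤ ∣ p ∣ → ∃₂ λ x y → x ∈ p × y ∈ p × x ≢ y
2≤∣p∣⇒distinct-pair (inside ∷ p) 2≤∣p∣ with y , y∈p ← 1≤∣p∣⇒nonempty p (s≤s⁻¹ 2≤∣p∣) =
  fzero , fsuc y , here , there y∈p , λ ()
2≤∣p∣⇒distinct-pair (outside ∷ p) 2≤∣p∣ with x , y , x∈p , y∈p , x≢y ← 2≤∣p∣⇒distinct-pair p 2≤∣p∣ =
  fsuc x , fsuc y , there x∈p , there y∈p , x≢y ∘ suc-injective

x∈p⇒suc∣p-x∣≡∣p∣ : ∀ {n} (p : Subset n) {x} → x ∈ p → suc ∣ p - x ∣ ≡ ∣ p ∣
x∈p⇒suc∣p-x∣≡∣p∣ (inside ∷ p) here = cong (suc ∘ ∣_∣) (p─⊥≡p p)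
x∈p⇒suc∣p-x∣≡∣p∣ (inside ∷ p) (there x∈p) = cong suc (x∈p⇒suc∣p-x∣≡∣p∣ p x∈p)
x∈p⇒suc∣p-x∣≡∣p∣ (outside ∷ p) (there x∈p) = x∈p⇒suc∣p-x∣≡∣p∣ p x∈p

∣p∪q∣+∣p∩q∣≡∣p∣+∣q∣ : ∀ {n} (p q : Subset n) → ∣ p ∪ q ∣ + ∣ p ∩ q ∣ ≡ ∣ p ∣ + ∣ q ∣
∣p∪q∣+∣p∩q∣≡∣p∣+∣q∣ [] [] = refl
∣p∪q∣+∣p∩q∣≡∣p∣+∣q∣ (inside ∷ p) (inside ∷ q) =
  cong suc (trans (+-suc _ _) (trans (cong suc (∣p∪q∣+∣p∩q∣≡∣p∣+∣q∣ p q)) (sym (+-suc _ _))))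
∣p∪q∣+∣p∩q∣≡∣p∣+∣q∣ (inside ∷ p) (outside ∷ q) = cong suc (∣p∪q∣+∣p∩q∣≡∣p∣+∣q∣ p q)
∣p∪q∣+∣p∩q∣≡∣p∣+∣q∣ (outside ∷ p) (inside ∷ q) =
  trans (cong suc (∣p∪q∣+∣p∩q∣≡∣p∣+∣q∣ p q)) (sym (+-suc _ _))
∣p∪q∣+∣p∩q∣≡∣p∣+∣q∣ (outside ∷ p) (outside ∷ q) = ∣p∪q∣+∣p∩q∣≡∣p∣+∣q∣ p q

x∉p⇒∣⁅x⁆∪p∣≡suc∣p∣ : ∀ {n} (x : Fin n) (p : Subset n) → x ∉ p → ∣ ⁅ x ⁆ ∪ p ∣ ≡ suc ∣ p ∣
x∉p⇒∣⁅x⁆∪p∣≡suc∣p∣ fzero (inside ∷ p) x∉p = contradiction here x∉p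
x∉p⇒∣⁅x⁆∪p∣≡suc∣p∣ fzero (outside ∷ p) _ = cong (suc ∘ ∣_∣) (∪-identityˡ p)
x∉p⇒∣⁅x⁆∪p∣≡suc∣p∣ (fsuc x) (inside ∷ p) x∉p = cong suc (x∉p⇒∣⁅x⁆∪p∣≡suc∣p∣ x p (x∉p ∘ there))
x∉p⇒∣⁅x⁆∪p∣≡suc∣p∣ (fsuc x) (outside ∷ p) x∉p = x∉p⇒∣⁅x⁆∪p∣≡suc∣p∣ x p (x∉p ∘ there)

p⊆r⇒q⊆r⇒p∪q⊆r : ∀ {n} {p q r : Subset n} → p ⊆ r → q ⊆ r → p ∪ q ⊆ r
p⊆r⇒q⊆r⇒p∪q⊆r {p = p} {q} p⊆r q⊆r x∈p∪q = [ p⊆r , q⊆r ]′ (x∈p∪q⁻ p q x∈p∪q)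

x∈p⇒⁅x⁆⊆p : ∀ {n} {x : Fin n} {p} → x ∈ p → ⁅ x ⁆ ⊆ p
x∈p⇒⁅x⁆⊆p {x = x} x∈p y∈⁅x⁆ = subst (_∈ _) (sym (x∈⁅y⁆⇒x≡y x y∈⁅x⁆)) x∈p

triple : ∀ {n} → Fin n → Fin n → Fin n → Subset n
triple a b c = ⁅ a ⁆ ∪ (⁅ b ⁆ ∪ ⁅ c ⁆)

module _ {n} {a b c : Fin n} where

  ∣triple∣≡3 : a ≢ b → a ≢ c → b ≢ c → ∣ triple a b c ∣ ≡ 3
  ∣triple∣≡3 a≢b a≢c b≢c = begin
    ∣ ⁅ a ⁆ ∪ (⁅ b ⁆ ∪ ⁅ c ⁆) ∣  ≡⟨ x∉p⇒∣⁅x⁆∪p∣≡suc∣p∣ a _ a∉bc ⟩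
    suc ∣ ⁅ b ⁆ ∪ ⁅ c ⁆ ∣        ≡⟨ cong suc (x∉p⇒∣⁅x⁆∪p∣≡suc∣p∣ b _ (x≢y⇒x∉⁅y⁆ b≢c)) ⟩
    suc (suc ∣ ⁅ c ⁆ ∣)          ≡⟨ cong (suc ∘ suc) (∣⁅x⁆∣≡1 c) ⟩
    3                            ∎
    where
    open ≡-Reasoning
    a∉bc : a ∉ ⁅ b ⁆ ∪ ⁅ c ⁆
    a∉bc = [ x≢y⇒x∉⁅y⁆ a≢b , x≢y⇒x∉⁅y⁆ a≢c ]′ ∘ x∈p∪q⁻ ⁅ b ⁆ ⁅ c ⁆

  triple⊆ : ∀ {p} → a ∈ p → b ∈ p → c ∈ p → triple a b c ⊆ p
  triple⊆ a∈p b∈p c∈p =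
    p⊆r⇒q⊆r⇒p∪q⊆r (x∈p⇒⁅x⁆⊆p a∈p) (p⊆r⇒q⊆r⇒p∪q⊆r (x∈p⇒⁅x⁆⊆p b∈p) (x∈p⇒⁅x⁆⊆p c∈p))

  a∈triple : a ∈ triple a b c
  a∈triple = x∈p∪q⁺ (inj₁ (x∈⁅x⁆ a))

  b∈triple : b ∈ triple a b c
  b∈triple = x∈p∪q⁺ (inj₂ (x∈p∪q⁺ (inj₁ (x∈⁅x⁆ b))))

  c∈triple : c ∈ triple a b c
  c∈triple = x∈p∪q⁺ (inj₂ (x∈p∪q⁺ (inj₂ (x∈⁅x⁆ c))))

module _ {n} {Line : Set} (On : Line → Fin n → Set) where

  AllOn : Line → Subset n → Set
  AllOn L S = ∀ x → x ∈ S → On L x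

  Collinear : Subset n → Set
  Collinear S = ∃ λ L → AllOn L S

-- Δ is a parameter rather than being defined as the collinear triples, so that
-- Circuit below unfolds to GCircuit k l when Δ = InΔ k l.
module LineMatroid
  {n} {Line : Set} (On : Line → Fin n → Set)
  (two-points-one-line : ∀ {L L′ x y} → x ≢ y → On L x → On L y → On L′ x → On L′ y → L ≡ L′)
  (Δ : Subset n → Set) (Δ? : Decidable Δ) (Δ⇔ : ∀ {S} → Δ S ⇔ (∣ S ∣ ≡ 3 × Collinear On S))
  where

  Family : Subset n → Set
  Family S = Δ S ⊎ ∣ S ∣ ≡ 4

  Circuit : Subset n → Set
  Circuit S = Family S × (∀ T → Family T → T ⊆ S → T ≡ S)

  Hyperplane : Subset n → Set
  Hyperplane = IsDependentHyperplane Circuit 3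

  Δ⇒∣S∣≡3 : ∀ {S} → Δ S → ∣ S ∣ ≡ 3
  Δ⇒∣S∣≡3 = proj₁ ∘ Equivalence.to Δ⇔

  Δ⇒collinear : ∀ {S} → Δ S → Collinear On S
  Δ⇒collinear = proj₂ ∘ Equivalence.to Δ⇔

  collinear⇒Δ : ∀ {S} → ∣ S ∣ ≡ 3 → Collinear On S → Δ S
  collinear⇒Δ ∣S∣≡3 col = Equivalence.from Δ⇔ (∣S∣≡3 , col)

  collinear-⊆ : ∀ {S T} → S ⊆ T → Collinear On T → Collinear On S
  collinear-⊆ S⊆T (L , T-on) = L , λ x → T-on x ∘ S⊆T

  family⇒3≤∣S∣ : ∀ {S} → Family S → 3 ≤ ∣ S ∣
  family⇒3≤∣S∣ (inj₁ ΔS) = ≤-reflexive (sym (Δ⇒∣S∣≡3 ΔS))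
  family⇒3≤∣S∣ (inj₂ ∣S∣≡4) = ≤-trans (ℕ.n≤1+n 3) (≤-reflexive (sym ∣S∣≡4))

  Δ⇒circuit : ∀ {S} → Δ S → Circuit S
  Δ⇒circuit {S} ΔS = inj₁ ΔS , λ T famT T⊆S →
    p⊆q⇒∣q∣≤∣p∣⇒p≡q T S T⊆S (subst (_≤ ∣ T ∣) (sym (Δ⇒∣S∣≡3 ΔS)) (family⇒3≤∣S∣ famT))

  circuit⇒Δ : ∀ {S} → Circuit S → ∣ S ∣ ≡ 3 → Δ S
  circuit⇒Δ (inj₁ ΔS , _) _ = ΔS
  circuit⇒Δ (inj₂ ∣S∣≡4 , _) ∣S∣≡3 with () ← trans (sym ∣S∣≡4) ∣S∣≡3

  collinear⇒triples-circuits : ∀ {S} → Collinear On S → AllRSubsetsCircuits Circuit 3 S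
  collinear⇒triples-circuits col T T⊆S ∣T∣≡3 = Δ⇒circuit (collinear⇒Δ ∣T∣≡3 (collinear-⊆ T⊆S col))

  family⇒∃circuit⊆ : ∀ {F} → Family F → ∃ λ E → Circuit E × E ⊆ F
  family⇒∃circuit⊆ {F} famF with anySubset? (λ T → T ⊆? F ×-dec Δ? T)
  ... | yes (T , T⊆F , ΔT) = T , Δ⇒circuit ΔT , T⊆F
  ... | no ∄Δ⊆F = F , (famF , minimal famF) , ⊆-refl
    where
    minimal : Family F → ∀ T → Family T → T ⊆ F → T ≡ F
    minimal _ T (inj₁ ΔT) T⊆F = ⊥-elim (∄Δ⊆F (T , T⊆F , ΔT))
    minimal (inj₁ ΔF) _ _ _ = ⊥-elim (∄Δ⊆F (F , ⊆-refl , ΔF))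
    minimal (inj₂ ∣F∣≡4) T (inj₂ ∣T∣≡4) T⊆F =
      p⊆q⇒∣q∣≤∣p∣⇒p≡q T F T⊆F (≤-reflexive (trans ∣F∣≡4 (sym ∣T∣≡4)))

  4≤∣X∣⇒∃circuit⊆ : ∀ {X} → 4 ≤ ∣ X ∣ → ∃ λ E → Circuit E × E ⊆ X
  4≤∣X∣⇒∃circuit⊆ {X} 4≤∣X∣
    with Y , Y⊆X , ∣Y∣≡4 ← subset-of-size 4 X 4≤∣X∣
    with E , circE , E⊆Y ← family⇒∃circuit⊆ (inj₂ ∣Y∣≡4)
    = E , circE , ⊆-trans E⊆Y Y⊆X

  circuit-⊆⇒≡ : ∀ {P Q} → Circuit P → Circuit Q → P ⊆ Q → P ≡ Q
  circuit-⊆⇒≡ {P} (famP , _) (_ , minimalQ) = minimalQ P famP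

  circuit-≢⇒∣Q∣<∣P∪Q∣ : ∀ {P Q} → Circuit P → Circuit Q → P ≢ Q → ∣ Q ∣ < ∣ P ∪ Q ∣
  circuit-≢⇒∣Q∣<∣P∪Q∣ {P} {Q} circP circQ P≢Q with ∣ P ∪ Q ∣ ≤? ∣ Q ∣
  ... | no ∣P∪Q∣≰∣Q∣ = ≰⇒> ∣P∪Q∣≰∣Q∣
  ... | yes ∣P∪Q∣≤∣Q∣ = contradiction (circuit-⊆⇒≡ circP circQ P⊆Q) P≢Q
    where
    Q≡P∪Q : Q ≡ P ∪ Q
    Q≡P∪Q = p⊆q⇒∣q∣≤∣p∣⇒p≡q Q (P ∪ Q) (q⊆p∪q P Q) ∣P∪Q∣≤∣Q∣
    P⊆Q : P ⊆ Q
    P⊆Q = subst (_ ∈_) (sym Q≡P∪Q) ∘ p⊆p∪q Q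

  distinct-circuits-in-four-points : ∀ {P Q} → Circuit P → Circuit Q → P ≢ Q → ∣ P ∪ Q ∣ ≤ 4 →
                                     ∣ P ∣ ≡ 3 × ∣ Q ∣ ≡ 3 × ∣ P ∪ Q ∣ ≡ 4
  distinct-circuits-in-four-points {P} {Q} circP circQ P≢Q ∣P∪Q∣≤4 =
    squeeze (proj₁ circP) ∣P∣<∣P∪Q∣ , squeeze (proj₁ circQ) ∣Q∣<∣P∪Q∣ ,
    ≤-antisym ∣P∪Q∣≤4 (≤-trans (s≤s (family⇒3≤∣S∣ (proj₁ circQ))) ∣Q∣<∣P∪Q∣)
    where
    ∣Q∣<∣P∪Q∣ : ∣ Q ∣ < ∣ P ∪ Q ∣
    ∣Q∣<∣P∪Q∣ = circuit-≢⇒∣Q∣<∣P∪Q∣ circP circQ P≢Q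
    ∣P∣<∣P∪Q∣ : ∣ P ∣ < ∣ P ∪ Q ∣
    ∣P∣<∣P∪Q∣ = subst (λ X → ∣ P ∣ < ∣ X ∣) (∪-comm Q P) (circuit-≢⇒∣Q∣<∣P∪Q∣ circQ circP (P≢Q ∘ sym))
    squeeze : ∀ {S} → Family S → ∣ S ∣ < ∣ P ∪ Q ∣ → ∣ S ∣ ≡ 3
    squeeze famS ∣S∣<∣P∪Q∣ = ≤-antisym (s≤s⁻¹ (≤-trans ∣S∣<∣P∪Q∣ ∣P∪Q∣≤4)) (family⇒3≤∣S∣ famS)

  collinear-∪ : ∀ {P Q} → 2 ≤ ∣ P ∩ Q ∣ → Collinear On P → Collinear On Q → Collinear On (P ∪ Q)
  collinear-∪ {P} {Q} 2≤∣P∩Q∣ (L , P-on) (L′ , Q-on)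
    with x , y , x∈P∩Q , y∈P∩Q , x≢y ← 2≤∣p∣⇒distinct-pair (P ∩ Q) 2≤∣P∩Q∣
    with refl ← two-points-one-line x≢y (P-on x (p∩q⊆p P Q x∈P∩Q)) (P-on y (p∩q⊆p P Q y∈P∩Q))
                                        (Q-on x (p∩q⊆q P Q x∈P∩Q)) (Q-on y (p∩q⊆q P Q y∈P∩Q))
    = L , λ z → [ P-on z , Q-on z ]′ ∘ x∈p∪q⁻ P Q

  small-elimination⇒Δ : ∀ {P Q e} → Circuit P → Circuit Q → P ≢ Q → e ∈ P →
                        ∣ (P ∪ Q) - e ∣ ≤ 3 → Δ ((P ∪ Q) - e)
  small-elimination⇒Δ {P} {Q} {e} circP circQ P≢Q e∈P ∣X∣≤3 =
    from-sizes (distinct-circuits-in-four-points circP circQ P≢Q (subst (_≤ 4) suc∣X∣≡∣P∪Q∣ (s≤s ∣X∣≤3)))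
    where
    suc∣X∣≡∣P∪Q∣ : suc ∣ (P ∪ Q) - e ∣ ≡ ∣ P ∪ Q ∣
    suc∣X∣≡∣P∪Q∣ = x∈p⇒suc∣p-x∣≡∣p∣ (P ∪ Q) (x∈p∪q⁺ (inj₁ e∈P))

    from-sizes : ∣ P ∣ ≡ 3 × ∣ Q ∣ ≡ 3 × ∣ P ∪ Q ∣ ≡ 4 → Δ ((P ∪ Q) - e)
    from-sizes (∣P∣≡3 , ∣Q∣≡3 , ∣P∪Q∣≡4) =
      collinear⇒Δ (ℕ.suc-injective (trans suc∣X∣≡∣P∪Q∣ ∣P∪Q∣≡4))
        (collinear-⊆ (p─q⊆p (P ∪ Q) ⁅ e ⁆)
          (collinear-∪ (≤-reflexive (sym ∣P∩Q∣≡2))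
            (Δ⇒collinear (circuit⇒Δ circP ∣P∣≡3)) (Δ⇒collinear (circuit⇒Δ circQ ∣Q∣≡3))))
      where
      open ≡-Reasoning
      ∣P∩Q∣≡2 : ∣ P ∩ Q ∣ ≡ 2
      ∣P∩Q∣≡2 = +-cancelˡ-≡ 4 _ _ (begin
        4 + ∣ P ∩ Q ∣              ≡⟨ cong (_+ ∣ P ∩ Q ∣) ∣P∪Q∣≡4 ⟨
        ∣ P ∪ Q ∣ + ∣ P ∩ Q ∣      ≡⟨ ∣p∪q∣+∣p∩q∣≡∣p∣+∣q∣ P Q ⟩
        ∣ P ∣ + ∣ Q ∣              ≡⟨ cong₂ _+_ ∣P∣≡3 ∣Q∣≡3 ⟩
        4 + 2                      ∎)

  circuit-elimination : ∀ {P Q e} → Circuit P → Circuit Q → P ≢ Q → e ∈ P → e ∈ Q →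
                        ∃ λ E → Circuit E × E ⊆ (P ∪ Q) - e
  circuit-elimination {P} {Q} {e} circP circQ P≢Q e∈P _ with 4 ≤? ∣ (P ∪ Q) - e ∣
  ... | yes 4≤∣X∣ = 4≤∣X∣⇒∃circuit⊆ 4≤∣X∣
  ... | no 4≰∣X∣ =
    _ , Δ⇒circuit (small-elimination⇒Δ circP circQ P≢Q e∈P (s≤s⁻¹ (≰⇒> 4≰∣X∣))) , ⊆-refl

  ⊥-not-circuit : ¬ Circuit ⊥
  ⊥-not-circuit (fam⊥ , _) with () ← subst (3 ≤_) (∣⊥∣≡0 n) (family⇒3≤∣S∣ fam⊥)

  isMatroid : IsMatroidByCircuits Circuit
  isMatroid = record { C1 = ⊥-not-circuit ; C2 = circuit-⊆⇒≡ ; C3 = circuit-elimination }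

  non-collinear-triple⇒independent : ∀ {S} → ∣ S ∣ ≡ 3 → ¬ Collinear On S → Independent Circuit S
  non-collinear-triple⇒independent {S} ∣S∣≡3 S-non-collinear C C⊆S circC =
    S-non-collinear (Δ⇒collinear (subst Δ C≡S (circuit⇒Δ circC (trans (cong ∣_∣ C≡S) ∣S∣≡3))))
    where
    C≡S : C ≡ S
    C≡S = p⊆q⇒∣q∣≤∣p∣⇒p≡q C S C⊆S (subst (_≤ ∣ C ∣) (sym ∣S∣≡3) (family⇒3≤∣S∣ (proj₁ circC)))

  independent⇒∣I∣≤3 : ∀ {I} → Independent Circuit I → ∣ I ∣ ≤ 3
  independent⇒∣I∣≤3 {I} I-independent with 4 ≤? ∣ I ∣
  ... | no 4≰∣I∣ = s≤s⁻¹ (≰⇒> 4≰∣I∣)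
  ... | yes 4≤∣I∣ with E , circE , E⊆I ← 4≤∣X∣⇒∃circuit⊆ 4≤∣I∣ =
    contradiction circE (I-independent E E⊆I)

  isPaving : ∀ {T} → ∣ T ∣ ≡ 3 → ¬ Collinear On T → IsPaving Circuit 3
  isPaving {T} ∣T∣≡3 T-non-collinear =
    ((T , non-collinear-triple⇒independent ∣T∣≡3 T-non-collinear , ∣T∣≡3) , λ _ → independent⇒∣I∣≤3) ,
    circuit-sizes
    where
    circuit-sizes : ∀ S → Circuit S → ∣ S ∣ ≡ 3 ⊎ ∣ S ∣ ≡ 3 + 1
    circuit-sizes _ (inj₁ ΔS , _) = inj₁ (Δ⇒∣S∣≡3 ΔS)
    circuit-sizes _ (inj₂ ∣S∣≡4 , _) = inj₂ ∣S∣≡4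

  triples-circuits⇒triples-collinear : ∀ {H} → AllRSubsetsCircuits Circuit 3 H →
                                       ∀ T → T ⊆ H → ∣ T ∣ ≡ 3 → Collinear On T
  triples-circuits⇒triples-collinear triples T T⊆H ∣T∣≡3 =
    Δ⇒collinear (circuit⇒Δ (triples T T⊆H ∣T∣≡3) ∣T∣≡3)

  triples-circuits⇒third-point-on-line : ∀ {H L a b x} → AllRSubsetsCircuits Circuit 3 H →
    a ≢ b → x ≢ a → x ≢ b → a ∈ H → b ∈ H → x ∈ H → On L a → On L b → On L x
  triples-circuits⇒third-point-on-line triples a≢b x≢a x≢b a∈H b∈H x∈H La Lb
    with L′ , xab-on ← triples-circuits⇒triples-collinear triples _
                         (triple⊆ x∈H a∈H b∈H) (∣triple∣≡3 x≢a x≢b a≢b)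
    with refl ← two-points-one-line a≢b La Lb (xab-on _ b∈triple) (xab-on _ c∈triple)
    = xab-on _ a∈triple

  hyperplane⇒collinear : ∀ {H} → Hyperplane H → Collinear On H
  hyperplane⇒collinear {H} (3≤∣H∣ , triples , _)
    with T , T⊆H , ∣T∣≡3 ← subset-of-size 3 H 3≤∣H∣
    with L , T-on ← triples-circuits⇒triples-collinear triples T T⊆H ∣T∣≡3
    with a , b , a∈T , b∈T , a≢b ← 2≤∣p∣⇒distinct-pair T (≤-trans (ℕ.n≤1+n 2) (≤-reflexive (sym ∣T∣≡3)))
    = L , H-on
    where
    H-on : AllOn On L H
    H-on x x∈H with x ≟ a | x ≟ b
    ... | yes refl | _ = T-on a a∈T
    ... | no _ | yes refl = T-on b b∈T
    ... | no x≢a | no x≢b = triples-circuits⇒third-point-on-line triples a≢b x≢a x≢b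
                              (T⊆H a∈T) (T⊆H b∈T) x∈H (T-on a a∈T) (T-on b b∈T)

  hyperplanes-on-common-line : ∀ {H H′ L} → Hyperplane H → Hyperplane H′ →
                               AllOn On L H → AllOn On L H′ → H ≡ H′
  hyperplanes-on-common-line {H} {H′} {L} (3≤∣H∣ , _ , H-maximal) (_ , _ , H′-maximal) H-on H′-on =
    trans (sym (H-maximal (H ∪ H′) 3≤∣H∪H′∣ triples (p⊆p∪q H′)))
          (H′-maximal (H ∪ H′) 3≤∣H∪H′∣ triples (q⊆p∪q H H′))
    where
    3≤∣H∪H′∣ : ∣ H ∪ H′ ∣ ≥ 3
    3≤∣H∪H′∣ = ≤-trans 3≤∣H∣ (∣p∣≤∣p∪q∣ H H′)
    triples : AllRSubsetsCircuits Circuit 3 (H ∪ H′)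
    triples = collinear⇒triples-circuits (L , λ x → [ H-on x , H′-on x ]′ ∘ x∈p∪q⁻ H H′)

  isTame : (∀ {x L₁ L₂ L₃} → On L₁ x → On L₂ x → On L₃ x → L₁ ≡ L₂ ⊎ L₁ ≡ L₃ ⊎ L₂ ≡ L₃) →
           IsTame Circuit 3
  isTame at-most-two-lines H₁ H₂ H₃ hyp₁ hyp₂ hyp₃ H₁≢H₂ H₁≢H₃ H₂≢H₃ = Empty-unique no-common-point
    where
    no-common-point : Empty ((H₁ ∩ H₂) ∩ H₃)
    no-common-point (x , x∈H₁₂₃)
      with L₁ , H₁-on ← hyperplane⇒collinear hyp₁
      with L₂ , H₂-on ← hyperplane⇒collinear hyp₂
      with L₃ , H₃-on ← hyperplane⇒collinear hyp₃
      with x∈H₁₂ , x∈H₃ ← x∈p∩q⁻ (H₁ ∩ H₂) H₃ x∈H₁₂₃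
      with x∈H₁ , x∈H₂ ← x∈p∩q⁻ H₁ H₂ x∈H₁₂
      with at-most-two-lines (H₁-on x x∈H₁) (H₂-on x x∈H₂) (H₃-on x x∈H₃)
    ... | inj₁ refl = H₁≢H₂ (hyperplanes-on-common-line hyp₁ hyp₂ H₁-on H₂-on)
    ... | inj₂ (inj₁ refl) = H₁≢H₃ (hyperplanes-on-common-line hyp₁ hyp₃ H₁-on H₃-on)
    ... | inj₂ (inj₂ refl) = H₂≢H₃ (hyperplanes-on-common-line hyp₂ hyp₃ H₂-on H₃-on)

data GridLine (k l : ℕ) : Set where
  R : Fin k → GridLine k l
  C : Fin l → GridLine k l

module Grid (k l : ℕ) where

  OnGrid : GridLine k l → Fin (k * l) → Set
  OnGrid (R i) = InR k l i
  OnGrid (C j) = InC k l j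

  toℕ-combine′ : (j : Fin l) (i : Fin k) → toℕ (combine j i) ≡ toℕ j * k + toℕ i
  toℕ-combine′ j i = trans (toℕ-combine j i) (cong (_+ toℕ i) (*-comm k (toℕ j)))

  digits-unique : ∀ (j j′ : Fin l) (i i′ : Fin k) →
                  toℕ j * k + toℕ i ≡ toℕ j′ * k + toℕ i′ → j ≡ j′ × i ≡ i′
  digits-unique j j′ i i′ eq = combine-injective j i j′ i′ (toℕ-injective (begin
    toℕ (combine j i)     ≡⟨ toℕ-combine′ j i ⟩
    toℕ j * k + toℕ i     ≡⟨ eq ⟩
    toℕ j′ * k + toℕ i′   ≡⟨ toℕ-combine′ j′ i′ ⟨
    toℕ (combine j′ i′)   ∎))
    where open ≡-Reasoning

  R-unique : ∀ {i i′ x} → InR k l i x → InR k l i′ x → i ≡ i′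
  R-unique {i} {i′} (j , x≡) (j′ , x≡′) = proj₂ (digits-unique j j′ i i′ (trans (sym x≡) x≡′))

  C-unique : ∀ {j j′ x} → InC k l j x → InC k l j′ x → j ≡ j′
  C-unique {j} {j′} (i , x≡) (i′ , x≡′) = proj₁ (digits-unique j j′ i i′ (trans (sym x≡) x≡′))

  R∩C-unique : ∀ {i j x y} → InR k l i x → InC k l j x → InR k l i y → InC k l j y → x ≡ y
  R∩C-unique {i} {j} (q , x≡) (r , x≡′) (q′ , y≡) (r′ , y≡′)
    with refl , _ ← digits-unique q j i r (trans (sym x≡) x≡′)
    with refl , _ ← digits-unique q′ j i r′ (trans (sym y≡) y≡′)
    = toℕ-injective (trans x≡ (sym y≡))

  two-points-one-line : ∀ {L L′ x y} → x ≢ y →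
                        OnGrid L x → OnGrid L y → OnGrid L′ x → OnGrid L′ y → L ≡ L′
  two-points-one-line {R _} {R _} _ Lx _ L′x _ = cong R (R-unique Lx L′x)
  two-points-one-line {C _} {C _} _ Lx _ L′x _ = cong C (C-unique Lx L′x)
  two-points-one-line {R i} {C j} x≢y Lx Ly L′x L′y =
    contradiction (R∩C-unique {i} {j} Lx L′x Ly L′y) x≢y
  two-points-one-line {C j} {R i} x≢y Lx Ly L′x L′y =
    contradiction (R∩C-unique {i} {j} L′x Lx L′y Ly) x≢y

  at-most-two-lines : ∀ {x L₁ L₂ L₃} → OnGrid L₁ x → OnGrid L₂ x → OnGrid L₃ x →
                      L₁ ≡ L₂ ⊎ L₁ ≡ L₃ ⊎ L₂ ≡ L₃
  at-most-two-lines {L₁ = R _} {R _} on₁ on₂ _ = inj₁ (cong R (R-unique on₁ on₂))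
  at-most-two-lines {L₁ = C _} {C _} on₁ on₂ _ = inj₁ (cong C (C-unique on₁ on₂))
  at-most-two-lines {L₁ = R _} {C _} {R _} on₁ _ on₃ = inj₂ (inj₁ (cong R (R-unique on₁ on₃)))
  at-most-two-lines {L₁ = C _} {R _} {C _} on₁ _ on₃ = inj₂ (inj₁ (cong C (C-unique on₁ on₃)))
  at-most-two-lines {L₁ = R _} {C _} {C _} _ on₂ on₃ = inj₂ (inj₂ (cong C (C-unique on₂ on₃)))
  at-most-two-lines {L₁ = C _} {R _} {R _} _ on₂ on₃ = inj₂ (inj₂ (cong R (R-unique on₂ on₃)))

  InΔ⇔ : ∀ {S} → InΔ k l S ⇔ (∣ S ∣ ≡ 3 × Collinear OnGrid S)
  InΔ⇔ = mk⇔ to from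
    where
    to : ∀ {S} → InΔ k l S → ∣ S ∣ ≡ 3 × Collinear OnGrid S
    to (∣S∣≡3 , inj₁ (i , S-on)) = ∣S∣≡3 , R i , S-on
    to (∣S∣≡3 , inj₂ (j , S-on)) = ∣S∣≡3 , C j , S-on
    from : ∀ {S} → ∣ S ∣ ≡ 3 × Collinear OnGrid S → InΔ k l S
    from (∣S∣≡3 , R i , S-on) = ∣S∣≡3 , inj₁ (i , S-on)
    from (∣S∣≡3 , C j , S-on) = ∣S∣≡3 , inj₂ (j , S-on)

  InR? : ∀ i x → Dec (InR k l i x)
  InR? i x = any? λ j → toℕ x ℕ.≟ toℕ j * k + toℕ i

  InC? : ∀ j x → Dec (InC k l j x)
  InC? j x = any? λ i → toℕ x ℕ.≟ toℕ j * k + toℕ i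

  InΔ? : Decidable (InΔ k l)
  InΔ? S = (∣ S ∣ ℕ.≟ 3) ×-dec
    ((any? λ i → all? λ x → x ∈? S →-dec InR? i x) ⊎-dec (any? λ j → all? λ x → x ∈? S →-dec InC? j x))

  point : Fin l → Fin k → Fin (k * l)
  point j i = cast (*-comm l k) (combine j i)

  toℕ-point : ∀ j i → toℕ (point j i) ≡ toℕ j * k + toℕ i
  toℕ-point j i = trans (toℕ-cast (*-comm l k) (combine j i)) (toℕ-combine′ j i)

  point-injective : ∀ {j j′ i i′} → point j i ≡ point j′ i′ → j ≡ j′ × i ≡ i′
  point-injective {j} {j′} {i} {i′} eq =
    digits-unique j j′ i i′ (trans (sym (toℕ-point j i)) (trans (cong toℕ eq) (toℕ-point j′ i′)))

  point∈R : ∀ j i → InR k l i (point j i)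
  point∈R j i = j , toℕ-point j i

  point∈C : ∀ j i → InC k l j (point j i)
  point∈C j i = i , toℕ-point j i

  corner : Fin l → Fin l → Fin k → Fin k → Subset (k * l)
  corner j j′ i i′ = triple (point j i) (point j i′) (point j′ i)

  ∣corner∣≡3 : ∀ {j j′ i i′} → j ≢ j′ → i ≢ i′ → ∣ corner j j′ i i′ ∣ ≡ 3
  ∣corner∣≡3 j≢j′ i≢i′ =
    ∣triple∣≡3 (i≢i′ ∘ proj₂ ∘ point-injective)
               (j≢j′ ∘ proj₁ ∘ point-injective) (j≢j′ ∘ proj₁ ∘ point-injective)

  corner-non-collinear : ∀ {j j′ i i′} → j ≢ j′ → i ≢ i′ → ¬ Collinear OnGrid (corner j j′ i i′)
  corner-non-collinear {j} {j′} {i} {i′} j≢j′ i≢i′ (L , corner-on)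
    with refl ← two-points-one-line {L} {C j} (i≢i′ ∘ proj₂ ∘ point-injective)
                  (corner-on _ a∈triple) (corner-on _ b∈triple) (point∈C j i) (point∈C j i′)
    with () ← two-points-one-line {L} {R i} (j≢j′ ∘ proj₁ ∘ point-injective)
                (corner-on _ a∈triple) (corner-on _ c∈triple) (point∈R j i) (point∈R j′ i)

lemma5p3 : (k l : ℕ) → k ≥ 3 → l ≥ 3 →
    IsMatroidByCircuits (GCircuit k l) × IsPaving (GCircuit k l) 3 × IsTame (GCircuit k l) 3
lemma5p3 k l (s≤s (s≤s _)) (s≤s (s≤s _)) =
  isMatroid , isPaving (∣corner∣≡3 0≢1 0≢1) (corner-non-collinear 0≢1 0≢1) , isTame at-most-two-lines
  where
  open Grid k l
  open LineMatroid OnGrid two-points-one-line (InΔ k l) InΔ? InΔ⇔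
  0≢1 : ∀ {m} → fzero {suc m} ≢ fsuc fzero
  0≢1 ()
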